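{- For every integer $n\geq 4$, $\Gamma_b(C_n)=2\left(\left\lfloor\frac{n}{2}\right\rfloor-1\right)$, where $C_n$ is the cycle of order $n$.
   Context: For a graph $G=(V,E)$, a broadcast is a function $f:V\to\{0,\dots,\operatorname{diam}(G)\}$ with $f(v)\le e_G(v)$ (eccentricity) for all $v$. Let $V^+_f=\{v: f(v)>0\}$ and $H_f(u)=\{v\in V^+_f: d_G(u,v)\le f(v)\}$. The cost is $\sigma(f)=\sum_v f(v)$. $f$ is dominating if $|H_f(u)|\ge1$ for all $u\in V$; it is a minimal dominating broadcast if no dominating broadcast $g\ne f$ satisfies $g\le f$ pointwise. $\Gamma_b(G)$ is the maximum cost of a minimal dominating broadcast on $G$. -}

module Defs where

open import Data.Nat using (ℕ; zero; suc; _+_; _*_; _∸_; _≤_; _<_; _/_)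
open import Data.Fin using (Fin; toℕ)
open import Data.List using (List; map; allFin)
open import Data.Nat.ListAction using (sum)
open import Data.Product using (Σ; ∃; _×_; _,_)
open import Data.Sum using (_⊎_)
open import Relation.Nullary using (¬_)
open import Relation.Binary.PropositionalEquality using (_≡_)

record Graph (n : ℕ) : Set₁ where
  field
    Adj : Fin n → Fin n → Set

open Graph public

-- Within G k u v  :  there is a walk of length at most k from u to v,
-- i.e. d_G(u,v) ≤ k.
data Within {n : ℕ} (G : Graph n) : ℕ → Fin n → Fin n → Set where
  here : ∀ {k u} → Within G k u u
  step : ∀ {k u w v} → Adj G u w → Within G k w v → Within G (suc k) u v

-- k ≤ e_G(v) : some vertex u has d_G(v,u) ≥ k.
≤Ecc : ∀ {n} → Graph n → Fin n → ℕ → Set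
≤Ecc G v k = ∃ λ u → ∀ j → j < k → ¬ Within G j v u

CycleAdj : ∀ n → Fin n → Fin n → Set
CycleAdj n u v =
    suc (toℕ u) ≡ toℕ v ⊎ suc (toℕ v) ≡ toℕ u
  ⊎ (toℕ u ≡ 0 × suc (toℕ v) ≡ n) ⊎ (toℕ v ≡ 0 × suc (toℕ u) ≡ n)

C : ∀ n → Graph n
C n = record { Adj = CycleAdj n }

IsBroadcast : ∀ {n} → Graph n → (Fin n → ℕ) → Set
IsBroadcast G f = ∀ v → ≤Ecc G v (f v)

cost : ∀ {n} → (Fin n → ℕ) → ℕ
cost {n} f = sum (map f (allFin n))

IsDominating : ∀ {n} → Graph n → (Fin n → ℕ) → Set
IsDominating {n} G f = ∀ (u : Fin n) → ∃ λ v → 0 < f v × Within G (f v) u v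

IsDominatingBroadcast : ∀ {n} → Graph n → (Fin n → ℕ) → Set
IsDominatingBroadcast G f = IsBroadcast G f × IsDominating G f

IsMinimalDominatingBroadcast : ∀ {n} → Graph n → (Fin n → ℕ) → Set
IsMinimalDominatingBroadcast {n} G f =
  IsDominatingBroadcast G f ×
  (∀ (g : Fin n → ℕ) → IsDominatingBroadcast G g → (∀ v → g v ≤ f v) → ∀ v → g v ≡ f v)

UpperBroadcastNumber : ∀ {n} → Graph n → ℕ → Set
UpperBroadcastNumber {n} G m =
  (∃ λ (f : Fin n → ℕ) → IsMinimalDominatingBroadcast G f × cost f ≡ m) ×
  (∀ (f : Fin n → ℕ) → IsMinimalDominatingBroadcast G f → cost f ≤ m)

module Submission where

-- Let f be a minimal dominating broadcast on Cₙ and v a broadcasting vertex.  Lowering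
-- f(v) by one breaks domination, so some u hears v and nobody else, and hears v only at distance
-- exactly f(v) -- unless f(v) = 1 and u = v.  The arc from v to u, or {v, v+1} in the exceptional
-- case, has f(v) + 1 vertices, and arcs of distinct broadcasting vertices are disjoint: a common
-- vertex would bring each private vertex within range of the other broadcaster.  Hence
-- σ(f) + |V⁺| ≤ n.  If some f(v) ≥ ⌊n/2⌋ then, since every vertex is within ⌊n/2⌋ of v,
-- minimality forces f to broadcast ⌊n/2⌋ from v alone.
-- Otherwise f ≤ m = ⌊n/2⌋ - 1, so σ(f) ≤ m|V⁺| ≤ 2m when |V⁺| ≤ 2 and σ(f) ≤ n - 3 ≤ 2m otherwise.
--
-- Write n = 2m + a + 1 with a ∈ {1, 2} and broadcast m from the vertices m and m + a.
-- The vertices 0 and n - 1 are private boundary vertices of these two broadcasters, which forces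
-- every dominating broadcast below f to equal f.

open import Defs
open import Data.Empty using (⊥; ⊥-elim)
open import Data.Fin using (Fin; zero; suc; toℕ; fromℕ<)
open import Data.Fin.Properties
  using (any?; ¬∀⟶∃¬; injective⇒≤; toℕ-injective; toℕ<n; toℕ-fromℕ<) renaming (_≟_ to _≟ᶠ_)
open import Data.List using (List; []; _∷_; map; length; concat; lookup; applyUpTo; allFin)
open import Data.List.Membership.Propositional using (_∈_)
open import Data.List.Membership.Propositional.Properties using (∈-lookup; ∈-applyUpTo⁻)
open import Data.List.Properties using (length-++; length-applyUpTo; map-tabulate)
import Data.List.Relation.Unary.All as All
import Data.List.Relation.Unary.All.Properties as All
open import Data.List.Relation.Unary.AllPairs as AllPairs using ([]; _∷_)
import Data.List.Relation.Unary.AllPairs.Properties as AllPairs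
open import Data.List.Relation.Binary.Disjoint.Propositional using (Disjoint)
open import Data.List.Relation.Unary.Unique.Propositional using (Unique)
open import Data.List.Relation.Unary.Unique.Propositional.Properties using (applyUpTo⁺₁; concat⁺; allFin⁺)
open import Data.Nat
  using (ℕ; zero; suc; pred; _+_; _*_; _∸_; _≤_; _<_; _/_; _%_; z≤n; s≤s; z<s; s≤s⁻¹; _≤?_; _<?_;
         NonZero; >-nonZero)
open import Data.Nat.DivMod
open import Data.Nat.ListAction using (sum)
open import Data.Nat.Properties
open import Algebra.Properties.CommutativeSemigroup +-commutativeSemigroup using (interchange)
open import Data.Nat.Tactic.RingSolver using (solve-∀)
open import Data.Product using (∃; _×_; _,_; proj₁; proj₂)
open import Data.Sum as Sum using (_⊎_; inj₁; inj₂)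
open import Data.Vec.Functional using (updateAt)
open import Data.Vec.Functional.Properties using (updateAt-updates; updateAt-minimal)
open import Function using (_∘_; id)
open import Relation.Binary.PropositionalEquality
  using (_≡_; _≢_; refl; sym; trans; cong; cong₂; subst; subst₂; module ≡-Reasoning)
open import Relation.Nullary using (¬_; Dec; yes; no; contradiction)
open import Relation.Nullary.Decidable using (_×-dec_; _⊎-dec_; map′)

-- Arithmetic

pred<self : ∀ {m} → 0 < m → pred m < m
pred<self (s≤s _) = ≤-refl

suc≤2* : ∀ {m} → 1 ≤ m → suc m ≤ 2 * m
suc≤2* {m} 1≤m = subst (suc m ≤_) (cong (m +_) (sym (+-identityʳ m))) (+-monoˡ-≤ m 1≤m)

*2≡+ : ∀ k → k * 2 ≡ k + k
*2≡+ k = trans (*-comm k 2) (cong (k +_) (+-identityʳ k))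

2⌊n/2⌋≤n : ∀ n → n / 2 + n / 2 ≤ n
2⌊n/2⌋≤n n = subst (_≤ n) (*2≡+ (n / 2)) (m/n*n≤m n 2)

n≤1+2⌊n/2⌋ : ∀ n → n ≤ suc (n / 2 + n / 2)
n≤1+2⌊n/2⌋ n = begin
  n                   ≡⟨ m≡m%n+[m/n]*n n 2 ⟩
  n % 2 + n / 2 * 2   ≤⟨ +-monoˡ-≤ (n / 2 * 2) (≤-pred (m%n<n n 2)) ⟩
  suc (n / 2 * 2)     ≡⟨ cong suc (*2≡+ (n / 2)) ⟩
  suc (n / 2 + n / 2) ∎
  where open ≤-Reasoning

split-cycle : ∀ {n m} → n / 2 ≡ suc m → ∃ λ a → 0 < a × a ≤ 2 × n ≡ suc (m + a + m)
split-cycle {n} {m} half≡ = n ∸ suc (m + m) , m<n⇒0<n∸m 1+2m<n , a≤2 , n≡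
  where
  open ≤-Reasoning
  1+2m<n : suc (m + m) < n
  1+2m<n = begin
    suc (suc (m + m)) ≡⟨ cong suc (+-suc m m) ⟨
    suc m + suc m     ≡⟨ cong (λ h → h + h) half≡ ⟨
    n / 2 + n / 2     ≤⟨ 2⌊n/2⌋≤n n ⟩
    n                 ∎
  a≤2 : n ∸ suc (m + m) ≤ 2
  a≤2 = begin
    n ∸ suc (m + m)                   ≤⟨ ∸-monoˡ-≤ (suc (m + m)) n≤3+2m ⟩
    suc (suc m + suc m) ∸ suc (m + m) ≡⟨ cong (_∸ suc (m + m)) (3+2m m) ⟩
    2 + suc (m + m) ∸ suc (m + m)     ≡⟨ m+n∸n≡m 2 (suc (m + m)) ⟩
    2                                 ∎
    where
    n≤3+2m : n ≤ suc (suc m + suc m)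
    n≤3+2m = subst (λ h → n ≤ suc (h + h)) half≡ (n≤1+2⌊n/2⌋ n)
    3+2m : ∀ m → suc (suc m + suc m) ≡ 2 + suc (m + m)
    3+2m = solve-∀
  n≡ : n ≡ suc (m + (n ∸ suc (m + m)) + m)
  n≡ = sym (trans (rearrange m (n ∸ suc (m + m))) (m∸n+n≡m (<⇒≤ 1+2m<n)))
    where
    rearrange : ∀ m a → suc (m + a + m) ≡ a + suc (m + m)
    rearrange = solve-∀

arcs-sum : ∀ {a b n} → a ≤ b → b ≤ n → n ∸ b + a + (b ∸ a) ≡ n
arcs-sum {a} {b} {n} a≤b b≤n = begin
  n ∸ b + a + (b ∸ a)   ≡⟨ +-assoc (n ∸ b) a (b ∸ a) ⟩
  n ∸ b + (a + (b ∸ a)) ≡⟨ cong (n ∸ b +_) (m+[n∸m]≡n a≤b) ⟩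
  n ∸ b + b             ≡⟨ m∸n+n≡m b≤n ⟩
  n                     ∎
  where open ≡-Reasoning

crossing-boundaries : ∀ {a b l₁ r₁ l₂ r₂} →
                      l₁ + r₁ ≤ a → l₂ + r₂ ≤ b → b < r₁ + l₂ → a < r₂ + l₁ → ⊥
crossing-boundaries {a} {b} {l₁} {r₁} {l₂} {r₂} B₁ B₂ gap₁ gap₂ =
  <-irrefl (rearrange l₁ r₁ l₂ r₂) (begin-strict
    (l₁ + r₁) + (l₂ + r₂) ≤⟨ +-mono-≤ B₁ B₂ ⟩
    a + b                 <⟨ +-mono-< gap₂ gap₁ ⟩
    (r₂ + l₁) + (r₁ + l₂) ∎)
  where
  open ≤-Reasoning
  rearrange : ∀ l₁ r₁ l₂ r₂ → (l₁ + r₁) + (l₂ + r₂) ≡ (r₂ + l₁) + (r₁ + l₂)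
  rearrange = solve-∀

crossing-self-boundary : ∀ {b l₁ l₂ r₂} →
                         l₁ ≤ 1 → l₂ + r₂ ≤ b → b < l₁ + l₂ → 1 < r₂ + l₁ → ⊥
crossing-self-boundary {b} {l₁} {l₂} {r₂} l₁≤1 B gap₁ gap₂ =
  <⇒≱ gap₂ (+-mono-≤ (≤-pred (≤-trans r₂<l₁ l₁≤1)) l₁≤1)
  where
  r₂<l₁ : r₂ < l₁
  r₂<l₁ = +-cancelˡ-< l₂ r₂ l₁ (≤-trans (s≤s B) (subst (b <_) (+-comm l₁ l₂) gap₁))

crossing-selves : ∀ {l₁ r₁ l₂ r₂} →
                  l₁ + r₁ ≤ 1 → l₂ + r₂ ≤ 1 → 1 < l₁ + l₂ → r₁ ≡ 0 × r₂ ≡ 0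
crossing-selves {l₁} {r₁} {l₂} {r₂} B₁ B₂ gap =
  m+n≡0⇒m≡0 r₁ r₁+r₂≡0 , m+n≡0⇒n≡0 r₁ r₁+r₂≡0
  where
  open ≤-Reasoning
  r₁+r₂≡0 : r₁ + r₂ ≡ 0
  r₁+r₂≡0 = n≤0⇒n≡0 (+-cancelˡ-≤ (l₁ + l₂) (r₁ + r₂) 0 (begin
    (l₁ + l₂) + (r₁ + r₂) ≡⟨ interchange l₁ r₁ l₂ r₂ ⟨
    (l₁ + r₁) + (l₂ + r₂) ≤⟨ +-mono-≤ B₁ B₂ ⟩
    2                     ≤⟨ gap ⟩
    l₁ + l₂               ≡⟨ +-identityʳ (l₁ + l₂) ⟨
    (l₁ + l₂) + 0         ∎))

positive : ℕ → ℕ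
positive zero    = 0
positive (suc _) = 1

≤*positive : ∀ {m M} → m ≤ M → m ≤ M * positive m
≤*positive {zero}        _   = z≤n
≤*positive {suc _} {M} m≤M = subst (_ ≤_) (sym (*-identityʳ M)) m≤M

cost≤2m : ∀ {c b m} → c ≤ m * b → c + b ≤ suc (suc m + suc m) → c ≤ 2 * m
cost≤2m {c} {b} {m} c≤mb c+b≤ with b ≤? 2
... | yes b≤2 = ≤-trans c≤mb (subst (m * b ≤_) (*-comm m 2) (*-monoʳ-≤ m b≤2))
... | no  b≰2 = +-cancelʳ-≤ 3 c (2 * m) (begin
  c + 3               ≤⟨ +-monoʳ-≤ c (≰⇒> b≰2) ⟩
  c + b               ≤⟨ c+b≤ ⟩
  suc (suc m + suc m) ≡⟨ 3+2m m ⟩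
  2 * m + 3           ∎)
  where
  open ≤-Reasoning
  3+2m : ∀ m → suc (suc m + suc m) ≡ 2 * m + 3
  3+2m = solve-∀

-- Sums and lengths of lists

module _ {A : Set} where

  sum-map-+ : ∀ (F G : A → ℕ) xs → sum (map (λ x → F x + G x) xs) ≡ sum (map F xs) + sum (map G xs)
  sum-map-+ F G []       = refl
  sum-map-+ F G (x ∷ xs) =
    trans (cong (F x + G x +_) (sum-map-+ F G xs)) (interchange (F x) (G x) _ _)

  sum-map-cong : ∀ {F G : A → ℕ} → (∀ x → F x ≡ G x) → ∀ xs → sum (map F xs) ≡ sum (map G xs)
  sum-map-cong F≗G []       = refl
  sum-map-cong F≗G (x ∷ xs) = cong₂ _+_ (F≗G x) (sum-map-cong F≗G xs)

  sum≤max*count : ∀ {M} (F : A → ℕ) → (∀ x → F x ≤ M) → ∀ xs →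
                  sum (map F xs) ≤ M * sum (map (positive ∘ F) xs)
  sum≤max*count         F F≤M []       = z≤n
  sum≤max*count {M = M} F F≤M (x ∷ xs) = begin
    F x + sum (map F xs)
      ≤⟨ +-mono-≤ (≤*positive (F≤M x)) (sum≤max*count F F≤M xs) ⟩
    M * positive (F x) + M * sum (map (positive ∘ F) xs) ≡⟨ *-distribˡ-+ M _ _ ⟨
    M * sum (map (positive ∘ F) (x ∷ xs))                ∎
    where open ≤-Reasoning

  length-concat-map : ∀ {B : Set} (g : B → List A) xs →
                      length (concat (map g xs)) ≡ sum (map (length ∘ g) xs)
  length-concat-map g []       = refl
  length-concat-map g (x ∷ xs) = trans (length-++ (g x)) (cong (length (g x) +_) (length-concat-map g xs))

  lookup-injective : ∀ {xs : List A} → Unique xs → ∀ {i j} → lookup xs i ≡ lookup xs j → i ≡ j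
  lookup-injective (_  ∷ _) {zero}  {zero}  _  = refl
  lookup-injective (x∉ ∷ _) {zero}  {suc j} eq = contradiction eq (All.lookup x∉ (∈-lookup j))
  lookup-injective (x∉ ∷ _) {suc i} {zero}  eq = contradiction (sym eq) (All.lookup x∉ (∈-lookup i))
  lookup-injective (_  ∷ u) {suc i} {suc j} eq = cong suc (lookup-injective u eq)

Unique⇒length≤ : ∀ {n} {xs : List (Fin n)} → Unique xs → length xs ≤ n
Unique⇒length≤ u = injective⇒≤ (lookup-injective u)

broadcasters : ∀ {n} → (Fin n → ℕ) → ℕ
broadcasters {n} f = sum (map (positive ∘ f) (allFin n))

single : ∀ {n} → Fin n → ℕ → Fin n → ℕ
single v c = updateAt (λ _ → 0) v (λ _ → c)

single-self : ∀ {n c} (v : Fin n) → single v c v ≡ c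
single-self v = updateAt-updates v (λ _ → 0)

single-other : ∀ {n c} {v w : Fin n} → w ≢ v → single v c w ≡ 0
single-other {v = v} {w} w≢v = updateAt-minimal w v (λ _ → 0) w≢v

cost-suc : ∀ {n} (g : Fin (suc n) → ℕ) → cost g ≡ g zero + cost (g ∘ suc)
cost-suc g = cong (g zero +_) (cong sum (trans (map-tabulate suc g) (sym (map-tabulate id (g ∘ suc)))))

cost-single : ∀ {n} (v : Fin n) c → cost (single v c) ≡ c
cost-single {suc n} zero    c =
  trans (cost-suc {n} (single zero c)) (trans (cong (c +_) (cost-zero n)) (+-identityʳ c))
  where
  cost-zero : ∀ n → cost {n} (λ _ → 0) ≡ 0
  cost-zero zero    = refl
  cost-zero (suc n) = trans (cost-suc {n} (λ _ → 0)) (cost-zero n)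
cost-single {suc n} (suc v) c = trans (cost-suc {n} (single (suc v) c)) (cost-single v c)

-- Broadcasts on an arbitrary graph

module Broadcasts {n : ℕ} (G : Graph n) where

  within-mono : ∀ {j k x y} → j ≤ k → Within G j x y → Within G k x y
  within-mono _          here       = here
  within-mono (s≤s j≤k) (step a w) = step a (within-mono j≤k w)

  within-trans : ∀ {j k x y z} → Within G j x y → Within G k y z → Within G (j + k) x z
  within-trans {j} {k} here w′ = within-mono (m≤n+m k j) w′
  within-trans (step a w) w′   = step a (within-trans w w′)

  within-sym : (∀ {x y} → Adj G x y → Adj G y x) → ∀ {k x y} → Within G k x y → Within G k y x
  within-sym adj-sym here                       = here
  within-sym adj-sym {suc k} {x} {y} (step a w) =
    subst (λ j → Within G j y x) (+-comm k 1) (within-trans (within-sym adj-sym w) (step (adj-sym a) here))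

  within-zero : ∀ {x y} → Within G 0 x y → x ≡ y
  within-zero here = refl

  ≤Ecc-mono : ∀ {v j k} → j ≤ k → ≤Ecc G v k → ≤Ecc G v j
  ≤Ecc-mono j≤k (u , far) = u , λ i i<j → far i (≤-trans i<j j≤k)

  IsBroadcast-mono : ∀ {f g} → (∀ v → g v ≤ f v) → IsBroadcast G f → IsBroadcast G g
  IsBroadcast-mono g≤f fB v = ≤Ecc-mono (g≤f v) (fB v)

  module _ (f : Fin n → ℕ) where

    Hears : Fin n → Fin n → Set
    Hears u v = 0 < f v × Within G (f v) u v

    PrivateTo : Fin n → Fin n → Set
    PrivateTo v u = ∀ w → w ≢ v → ¬ Hears u w

    record PrivateBoundary (v u : Fin n) : Set where
      field
        isPrivate : PrivateTo v u
        reaches   : Within G (f v) u v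
        exact     : ∀ {k} → k < f v → ¬ Within G k u v

  open PrivateBoundary public

  hears : ∀ f {u v c} → f v ≡ c → 0 < c → Within G c u v → Hears f u v
  hears f {u} {v} fv≡c c>0 u~v = subst (λ k → 0 < k × Within G k u v) (sym fv≡c) (c>0 , u~v)

  boundaries⇒minimal : ∀ {f g} → (∀ v → 0 < f v → ∃ (PrivateBoundary f v)) →
                       IsDominating G g → (∀ v → g v ≤ f v) → ∀ v → g v ≡ f v
  boundaries⇒minimal {f} {g} boundary gD g≤f v with 0 <? f v
  ... | no  f≯0 = ≤-antisym (g≤f v) (≤-trans (≮⇒≥ f≯0) z≤n)
  ... | yes f>0 = ≤-antisym (g≤f v) (forced (proj₂ (boundary v f>0)))
    where
    forced : ∀ {u} → PrivateBoundary f v u → f v ≤ g v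
    forced {u} b with gD u
    ... | w , g>0 , u~w with w ≟ᶠ v
    ...   | yes refl = ≮⇒≥ (λ g<f → exact b g<f u~w)
    ...   | no  w≢v  = ⊥-elim (isPrivate b w w≢v (≤-trans g>0 (g≤f w) , within-mono (g≤f w) u~w))

  module _ (within? : ∀ k x y → Dec (Within G k x y)) {f} (minimal : IsMinimalDominatingBroadcast G f) where

    minimal⇒boundary : ∀ {v} → 0 < f v → ∃ (PrivateBoundary f v) ⊎ (f v ≡ 1 × PrivateTo f v v)
    minimal⇒boundary {v} f>0 =
      classify (¬∀⟶∃¬ n _ (λ u → any? λ w → (0 <? g w) ×-dec within? (g w) u w) g-fails)
      where
      g : Fin n → ℕ
      g = updateAt f v pred

      g-v : g v ≡ pred (f v)
      g-v = updateAt-updates v f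

      g≤f : ∀ w → g w ≤ f w
      g≤f w with w ≟ᶠ v
      ... | yes refl = subst (_≤ f v) (sym g-v) pred[n]≤n
      ... | no  w≢v  = ≤-reflexive (updateAt-minimal w v f w≢v)

      g-fails : ¬ IsDominating G g
      g-fails gD = <⇒≢ (pred<self f>0) (trans (sym g-v) g≡f)
        where
        g≡f : g v ≡ f v
        g≡f = proj₂ minimal g (IsBroadcast-mono g≤f (proj₁ (proj₁ minimal)) , gD) g≤f v

      hears-other : ∀ {u w} → w ≢ v → Hears f u w → Hears g u w
      hears-other w≢v (f>0 , u~w) = hears g (updateAt-minimal _ v f w≢v) f>0 u~w

      unheard⇒private : ∀ {u} → ¬ ∃ (Hears g u) → PrivateTo f v u
      unheard⇒private unheard w w≢v h = unheard (w , hears-other w≢v h)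

      classify : (∃ λ u → ¬ ∃ (Hears g u)) → ∃ (PrivateBoundary f v) ⊎ (f v ≡ 1 × PrivateTo f v v)
      classify (u , unheard) with proj₂ (proj₁ minimal) u
      ... | w , u-hears-w with w ≟ᶠ v
      ...   | no  w≢v  = ⊥-elim (unheard (w , hears-other w≢v u-hears-w))
      ...   | yes refl with u ≟ᶠ v
      ...     | yes refl = inj₂ (f≡1 , unheard⇒private unheard)
        where
        f≡1 : f v ≡ 1
        f≡1 = pred≡0⇒≡1 f>0 (n≤0⇒n≡0 (≮⇒≥ λ p>0 → unheard (v , hears g g-v p>0 here)))
          where
          pred≡0⇒≡1 : ∀ {m} → 0 < m → pred m ≡ 0 → m ≡ 1
          pred≡0⇒≡1 (s≤s _) = cong suc
      ...     | no  u≢v  = inj₁ (u , record { isPrivate = unheard⇒private unheard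
                                           ; reaches   = proj₂ u-hears-w
                                           ; exact     = closer-unheard })
        where
        closer-unheard : ∀ {k} → k < f v → ¬ Within G k u v
        closer-unheard {zero}  _   u~v = u≢v (within-zero u~v)
        closer-unheard {suc k} k<f u~v =
          unheard (v , hears g g-v (≤-trans z<s (<⇒≤pred k<f)) (within-mono (<⇒≤pred k<f) u~v))

-- The cycle Cₙ

module Cycle (n : ℕ) (1<n : 1 < n) where

  instance
    n≢0 : NonZero n
    n≢0 = >-nonZero (<-trans z<s 1<n)

  open Broadcasts (C n) public hiding (within-sym)

  cycleAdj-sym : ∀ {x y} → CycleAdj n x y → CycleAdj n y x
  cycleAdj-sym (inj₁ e)               = inj₂ (inj₁ e)
  cycleAdj-sym (inj₂ (inj₁ e))        = inj₁ e
  cycleAdj-sym (inj₂ (inj₂ (inj₁ e))) = inj₂ (inj₂ (inj₂ e))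
  cycleAdj-sym (inj₂ (inj₂ (inj₂ e))) = inj₂ (inj₂ (inj₁ e))

  within-sym : ∀ {k x y} → Within (C n) k x y → Within (C n) k y x
  within-sym = Broadcasts.within-sym (C n) cycleAdj-sym

  shift : ℕ → Fin n → Fin n
  shift i x = fromℕ< (m%n<n (toℕ x + i) n)

  next : Fin n → Fin n
  next = shift 1

  toℕ-shift : ∀ i x → toℕ (shift i x) ≡ (toℕ x + i) % n
  toℕ-shift i x = toℕ-fromℕ< _

  shift≡ : ∀ i x {y} → (toℕ x + i) % n ≡ toℕ y → shift i x ≡ y
  shift≡ i x eq = toℕ-injective (trans (toℕ-shift i x) eq)

  shift-zero : ∀ x → shift 0 x ≡ x
  shift-zero x = shift≡ 0 x (trans (cong (_% n) (+-identityʳ (toℕ x))) (m<n⇒m%n≡m (toℕ<n x)))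

  shift-shift : ∀ i j x → shift j (shift i x) ≡ shift (i + j) x
  shift-shift i j x = shift≡ j (shift i x) (begin
    (toℕ (shift i x) + j) % n         ≡⟨ cong (λ t → (t + j) % n) (toℕ-shift i x) ⟩
    ((toℕ x + i) % n + j) % n         ≡⟨ %-distribˡ-+ ((toℕ x + i) % n) j n ⟩
    ((toℕ x + i) % n % n + j % n) % n ≡⟨ cong (λ t → (t + j % n) % n) (m%n%n≡m%n (toℕ x + i) n) ⟩
    ((toℕ x + i) % n + j % n) % n     ≡⟨ %-distribˡ-+ (toℕ x + i) j n ⟨
    (toℕ x + i + j) % n               ≡⟨ cong (_% n) (+-assoc (toℕ x) i j) ⟩
    (toℕ x + (i + j)) % n             ≡⟨ toℕ-shift (i + j) x ⟨
    toℕ (shift (i + j) x)             ∎)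
    where open ≡-Reasoning

  shift-suc : ∀ i x → shift (suc i) x ≡ next (shift i x)
  shift-suc i x = trans (cong (λ j → shift j x) (+-comm 1 i)) (sym (shift-shift i 1 x))

  shift-split : ∀ {j k} b → j ≤ k → shift (k ∸ j) (shift j b) ≡ shift k b
  shift-split {j} {k} b j≤k = trans (shift-shift j (k ∸ j) b) (cong (λ i → shift i b) (m+[n∸m]≡n j≤k))

  next-injective : ∀ {x y} → next x ≡ next y → x ≡ y
  next-injective {x} {y} eq = begin
    x                      ≡⟨ back x ⟨
    shift (n ∸ 1) (next x) ≡⟨ cong (shift (n ∸ 1)) eq ⟩
    shift (n ∸ 1) (next y) ≡⟨ back y ⟩
    y                      ∎
    where
    open ≡-Reasoning
    back : ∀ z → shift (n ∸ 1) (next z) ≡ z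
    back z = begin
      shift (n ∸ 1) (shift 1 z) ≡⟨ shift-shift 1 (n ∸ 1) z ⟩
      shift (1 + (n ∸ 1)) z     ≡⟨ cong (λ i → shift i z) (m+[n∸m]≡n (<-trans z<s 1<n)) ⟩
      shift n z                 ≡⟨ shift≡ n z (trans ([m+n]%n≡m%n (toℕ z) n) (m<n⇒m%n≡m (toℕ<n z))) ⟩
      z                         ∎

  toℕ-next : ∀ x → toℕ (next x) ≡ suc (toℕ x) % n
  toℕ-next x = trans (toℕ-shift 1 x) (cong (_% n) (+-comm (toℕ x) 1))

  next≢ : ∀ x → next x ≢ x
  next≢ x eq with m≤n⇒m<n∨m≡n (toℕ<n x)
  ... | inj₁ 1+x<n = 1+n≢n (trans (sym (m<n⇒m%n≡m 1+x<n)) (trans (sym (toℕ-next x)) (cong toℕ eq)))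
  ... | inj₂ 1+x≡n = <⇒≢ 1<n (trans (cong suc 0≡x) 1+x≡n)
    where
    0≡x : 0 ≡ toℕ x
    0≡x = trans (sym (n%n≡0 n)) (trans (cong (_% n) (sym 1+x≡n)) (trans (sym (toℕ-next x)) (cong toℕ eq)))

  private
    no-wrap : ∀ {a b} → suc b ≡ a → a < n → a ≡ suc b % n
    no-wrap 1+b≡a a<n = sym (trans (cong (_% n) 1+b≡a) (m<n⇒m%n≡m a<n))

    wrap : ∀ {a b} → a ≡ 0 → suc b ≡ n → a ≡ suc b % n
    wrap a≡0 1+b≡n = trans a≡0 (sym (trans (cong (_% n) 1+b≡n) (n%n≡0 n)))

  next-adjacent : ∀ x → CycleAdj n x (next x)
  next-adjacent x with m≤n⇒m<n∨m≡n (toℕ<n x)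
  ... | inj₁ 1+x<n = inj₁ (sym (trans (toℕ-next x) (m<n⇒m%n≡m 1+x<n)))
  ... | inj₂ 1+x≡n = inj₂ (inj₂ (inj₂ (trans (toℕ-next x) (sym (wrap refl 1+x≡n)) , 1+x≡n)))

  adjacent⇒next : ∀ {x y} → CycleAdj n x y → y ≡ next x ⊎ x ≡ next y
  adjacent⇒next {x} {y} adj = Sum.map (next-of x y) (next-of y x) (adjacent-mod adj)
    where
    next-of : ∀ x y → toℕ y ≡ suc (toℕ x) % n → y ≡ next x
    next-of x y eq = toℕ-injective (trans eq (sym (toℕ-next x)))
    adjacent-mod : CycleAdj n x y → toℕ y ≡ suc (toℕ x) % n ⊎ toℕ x ≡ suc (toℕ y) % n
    adjacent-mod (inj₁ 1+x≡y)                       = inj₁ (no-wrap 1+x≡y (toℕ<n y))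
    adjacent-mod (inj₂ (inj₁ 1+y≡x))                = inj₂ (no-wrap 1+y≡x (toℕ<n x))
    adjacent-mod (inj₂ (inj₂ (inj₁ (x≡0 , 1+y≡n)))) = inj₂ (wrap x≡0 1+y≡n)
    adjacent-mod (inj₂ (inj₂ (inj₂ (y≡0 , 1+x≡n)))) = inj₁ (wrap y≡0 1+x≡n)

  within-shift : ∀ i x → Within (C n) i x (shift i x)
  within-shift zero    x = subst (Within (C n) 0 x) (sym (shift-zero x)) here
  within-shift (suc i) x =
    step (next-adjacent x) (subst (Within (C n) i (next x)) (shift-shift 1 i x) (within-shift i (next x)))

  within-rest : ∀ {j k} b → j ≤ k → Within (C n) (k ∸ j) (shift j b) (shift k b)
  within-rest {j} {k} b j≤k =
    subst (Within (C n) (k ∸ j) (shift j b)) (shift-split b j≤k) (within-shift (k ∸ j) (shift j b))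

  Reach : ℕ → Fin n → Fin n → Set
  Reach i x y = y ≡ shift i x ⊎ x ≡ shift i y

  reach⇒within : ∀ {i x y} → Reach i x y → Within (C n) i x y
  reach⇒within (inj₁ refl) = within-shift _ _
  reach⇒within (inj₂ refl) = within-sym (within-shift _ _)

  within⇒reach : ∀ {k x y} → Within (C n) k x y → ∃ λ i → i ≤ k × Reach i x y
  within⇒reach here = 0 , z≤n , inj₁ (sym (shift-zero _))
  within⇒reach {x = x} (step adj w) with adjacent⇒next adj | within⇒reach w
  ... | inj₁ refl | i     , i≤k , inj₁ refl = suc i , s≤s i≤k , inj₁ (shift-shift 1 i x)
  ... | inj₁ refl | zero  , _   , inj₂ z≡y  = 1 , s≤s z≤n , inj₁ (trans (sym (shift-zero _)) (sym z≡y))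
  ... | inj₁ refl | suc i , i<k , inj₂ z≡y  =
        i , m≤n⇒m≤1+n (<⇒≤ i<k) , inj₂ (next-injective (trans z≡y (shift-suc i _)))
  ... | inj₂ refl | zero  , _   , inj₁ y≡z  =
        1 , s≤s z≤n , inj₂ (cong next (trans (sym (shift-zero _)) (sym y≡z)))
  ... | inj₂ refl | suc i , i<k , inj₁ y≡z  =
        i , m≤n⇒m≤1+n (<⇒≤ i<k) , inj₁ (trans y≡z (sym (shift-shift 1 i _)))
  ... | inj₂ refl | i     , i≤k , inj₂ refl = suc i , s≤s i≤k , inj₂ (sym (shift-suc i _))

  exact-reach : ∀ {k x y} → Within (C n) k x y → (∀ {j} → j < k → ¬ Within (C n) j x y) → Reach k x y
  exact-reach x~y closer with within⇒reach x~y
  ... | i , i≤k , r with m≤n⇒m<n∨m≡n i≤k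
  ...   | inj₁ i<k  = ⊥-elim (closer i<k (reach⇒within r))
  ...   | inj₂ refl = r

  within? : ∀ k x y → Dec (Within (C n) k x y)
  within? k x y =
    map′ fromReach toReach (anyUpTo? (λ i → (y ≟ᶠ shift i x) ⊎-dec (x ≟ᶠ shift i y)) (suc k))
    where
    fromReach : (∃ λ i → i < suc k × Reach i x y) → Within (C n) k x y
    fromReach (i , i<1+k , r) = within-mono (s≤s⁻¹ i<1+k) (reach⇒within r)
    toReach : Within (C n) k x y → ∃ λ i → i < suc k × Reach i x y
    toReach w with within⇒reach w
    ... | i , i≤k , r = i , s≤s i≤k , r

  within-forward : ∀ {x y} → toℕ x ≤ toℕ y → Within (C n) (toℕ y ∸ toℕ x) x y
  within-forward {x} {y} x≤y = subst (Within (C n) _ x) (shift≡ _ x eq) (within-shift _ x)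
    where
    eq : (toℕ x + (toℕ y ∸ toℕ x)) % n ≡ toℕ y
    eq = trans (cong (_% n) (m+[n∸m]≡n x≤y)) (m<n⇒m%n≡m (toℕ<n y))

  within-around : ∀ x y → Within (C n) (n ∸ toℕ y + toℕ x) y x
  within-around x y = subst (Within (C n) _ y) (shift≡ _ y eq) (within-shift _ y)
    where
    open ≡-Reasoning
    eq : (toℕ y + (n ∸ toℕ y + toℕ x)) % n ≡ toℕ x
    eq = begin
      (toℕ y + (n ∸ toℕ y + toℕ x)) % n ≡⟨ cong (_% n) (+-assoc (toℕ y) (n ∸ toℕ y) (toℕ x)) ⟨
      (toℕ y + (n ∸ toℕ y) + toℕ x) % n ≡⟨ cong (λ t → (t + toℕ x) % n) (m+[n∸m]≡n (<⇒≤ (toℕ<n y))) ⟩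
      (n + toℕ x) % n                   ≡⟨ cong (_% n) (+-comm n (toℕ x)) ⟩
      (toℕ x + n) % n                   ≡⟨ [m+n]%n≡m%n (toℕ x) n ⟩
      toℕ x % n                         ≡⟨ m<n⇒m%n≡m (toℕ<n x) ⟩
      toℕ x                             ∎

  within-half≤ : ∀ {x y} → toℕ x ≤ toℕ y → Within (C n) (n / 2) x y
  within-half≤ {x} {y} x≤y with toℕ y ∸ toℕ x ≤? n / 2
  ... | yes forward≤h = within-mono forward≤h (within-forward x≤y)
  ... | no  forward≰h = within-sym (within-mono around≤h (within-around x y))
    where
    open ≤-Reasoning
    around≤h : n ∸ toℕ y + toℕ x ≤ n / 2
    around≤h = +-cancelʳ-≤ (suc (n / 2)) _ _ (begin
      n ∸ toℕ y + toℕ x + suc (n / 2)     ≤⟨ +-monoʳ-≤ _ (≰⇒> forward≰h) ⟩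
      n ∸ toℕ y + toℕ x + (toℕ y ∸ toℕ x) ≡⟨ arcs-sum x≤y (<⇒≤ (toℕ<n y)) ⟩
      n                                   ≤⟨ n≤1+2⌊n/2⌋ n ⟩
      suc (n / 2 + n / 2)                 ≡⟨ +-suc (n / 2) (n / 2) ⟨
      n / 2 + suc (n / 2)                 ∎)

  within-half : ∀ x y → Within (C n) (n / 2) x y
  within-half x y with ≤-total (toℕ x) (toℕ y)
  ... | inj₁ x≤y = within-half≤ x≤y
  ... | inj₂ y≤x = within-sym (within-half≤ y≤x)

  ¬within-arc : ∀ {k x y} → toℕ x + k < toℕ y → toℕ y + k < n + toℕ x → ¬ Within (C n) k x y
  ¬within-arc {k} {x} {y} near far x~y with within⇒reach x~y
  ... | i , i≤k , inj₁ refl = <⇒≱ near (begin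
    toℕ (shift i x) ≡⟨ toℕ-shift i x ⟩
    (toℕ x + i) % n ≤⟨ m%n≤m (toℕ x + i) n ⟩
    toℕ x + i       ≤⟨ +-monoʳ-≤ (toℕ x) i≤k ⟩
    toℕ x + k       ∎)
    where open ≤-Reasoning
  ... | i , i≤k , inj₂ refl with toℕ y + i <? n
  ...   | yes no-wrap = <⇒≱ (≤-trans (s≤s (m≤m+n _ k)) near) (begin
    toℕ y           ≤⟨ m≤m+n (toℕ y) i ⟩
    toℕ y + i       ≡⟨ m<n⇒m%n≡m no-wrap ⟨
    (toℕ y + i) % n ≡⟨ toℕ-shift i y ⟨
    toℕ (shift i y) ∎)
    where open ≤-Reasoning
  ...   | no  wrap = <-irrefl refl (begin-strict
    toℕ (shift i y)         ≡⟨ toℕ-shift i y ⟩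
    (toℕ y + i) % n         ≡⟨ m≤n⇒[n∸m]%m≡n%m (≮⇒≥ wrap) ⟨
    (toℕ y + i ∸ n) % n     ≤⟨ m%n≤m (toℕ y + i ∸ n) n ⟩
    toℕ y + i ∸ n           <⟨ ∸-monoˡ-< (≤-trans (s≤s (+-monoʳ-≤ (toℕ y) i≤k)) far) (≮⇒≥ wrap) ⟩
    n + toℕ (shift i y) ∸ n ≡⟨ m+n∸m≡n n _ ⟩
    toℕ (shift i y)         ∎)
    where open ≤-Reasoning

  segment : Fin n → ℕ → List (Fin n)
  segment b k = applyUpTo (λ j → shift j b) (suc k)

  segment-unique : ∀ {b k} → ¬ Within (C n) (pred k) b (shift k b) → Unique (segment b k)
  segment-unique {b} {k} far = applyUpTo⁺₁ _ (suc k) λ {i} {j} i<j j<1+k eq →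
    far (within-mono (shortcut≤ i<j (s≤s⁻¹ j<1+k))
          (within-trans (within-shift i b)
            (subst (λ z → Within (C n) (k ∸ j) z (shift k b)) (sym eq) (within-rest b (s≤s⁻¹ j<1+k)))))
    where
    shortcut≤ : ∀ {i j} → i < j → j ≤ k → i + (k ∸ j) ≤ pred k
    shortcut≤ {i} {j} i<j j≤k =
      <⇒≤pred (subst (i + (k ∸ j) <_) (m+[n∸m]≡n j≤k) (+-monoˡ-< (k ∸ j) i<j))

  record Between (k : ℕ) (u v x : Fin n) : Set where
    field
      left right   : ℕ
      left+right≤k : left + right ≤ k
      to-left      : Within (C n) left x u
      to-right     : Within (C n) right x v

  open Between

  between-sym : ∀ {k u v x} → Between k u v x → Between k v u x
  between-sym {k} b = record
    { left     = right b ; right    = left b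
    ; to-left  = to-right b ; to-right = to-left b
    ; left+right≤k = subst (_≤ k) (+-comm (left b) (right b)) (left+right≤k b) }

  ∈segment⇒between : ∀ {b k x} → x ∈ segment b k → Between k b (shift k b) x
  ∈segment⇒between {b} {k} x∈ with ∈-applyUpTo⁻ (λ j → shift j b) x∈
  ... | j , j<1+k , refl = record
    { left     = j ; right = k ∸ j
    ; to-left  = within-sym (within-shift j b) ; to-right = within-rest b (s≤s⁻¹ j<1+k)
    ; left+right≤k = ≤-reflexive (m+[n∸m]≡n (s≤s⁻¹ j<1+k)) }

  arc : ∀ {k x y} → Reach k x y → List (Fin n)
  arc {k} {x}     (inj₁ _) = segment x k
  arc {k} {y = y} (inj₂ _) = segment y k

  length-arc : ∀ {k x y} (r : Reach k x y) → length (arc r) ≡ suc k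
  length-arc {k} {x}     (inj₁ _) = length-applyUpTo (λ j → shift j x) (suc k)
  length-arc {k} {y = y} (inj₂ _) = length-applyUpTo (λ j → shift j y) (suc k)

  arc-unique : ∀ {k x y} (r : Reach k x y) → ¬ Within (C n) (pred k) x y → Unique (arc r)
  arc-unique (inj₁ refl) far = segment-unique far
  arc-unique (inj₂ refl) far = segment-unique (far ∘ within-sym)

  ∈arc⇒between : ∀ {k x y z} (r : Reach k x y) → z ∈ arc r → Between k x y z
  ∈arc⇒between (inj₁ refl) z∈ = ∈segment⇒between z∈
  ∈arc⇒between (inj₂ refl) z∈ = between-sym (∈segment⇒between z∈)

  privacy-gap : ∀ {f v p w a b x} → PrivateTo f v p → w ≢ v → 0 < f w →
                Within (C n) a x p → Within (C n) b x w → f w < a + b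
  privacy-gap priv w≢v fw>0 x~p x~w =
    ≰⇒> λ a+b≤f → priv _ w≢v (fw>0 , within-mono a+b≤f (within-trans (within-sym x~p) x~w))

  boundary⇒≤Ecc : ∀ {f v u} → PrivateBoundary f v u → ≤Ecc (C n) v (f v)
  boundary⇒≤Ecc {u = u} b = u , λ k k<f v~u → exact b k<f (within-sym v~u)

  -- The upper bound

  module MinimalBroadcast {f} (minimal : IsMinimalDominatingBroadcast (C n) f) where

    data Privacy (v : Fin n) : Set where
      boundary : ∀ {p} → PrivateBoundary f v p → Privacy v
      self     : f v ≡ 1 → PrivateTo f v v → Privacy v

    privacy : ∀ v → 0 < f v → Privacy v
    privacy v fv>0 with minimal⇒boundary within? minimal fv>0
    ... | inj₁ (_ , b)        = boundary b
    ... | inj₂ (fv≡1 , priv) = self fv≡1 priv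

    endpoint : ∀ {v} → Privacy v → Fin n
    endpoint     (boundary {p} _) = p
    endpoint {v} (self _ _)       = shift (f v) v

    reach : ∀ {v} (s : Privacy v) → Reach (f v) v (endpoint s)
    reach (boundary b) = Sum.swap (exact-reach (reaches b) (exact b))
    reach (self _ _)   = inj₁ refl

    territory : ∀ {v} → Privacy v → List (Fin n)
    territory s = arc (reach s)

    territory-unique : ∀ {v} → 0 < f v → (s : Privacy v) → Unique (territory s)
    territory-unique fv>0 s@(boundary b) = arc-unique (reach s) (exact b (pred<self fv>0) ∘ within-sym)
    territory-unique {v} _ s@(self fv≡1 _) = arc-unique (reach s) far
      where
      far : ¬ Within (C n) (pred (f v)) v (shift (f v) v)
      far = subst (λ k → ¬ Within (C n) (pred k) v (shift k v)) (sym fv≡1)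
                  (λ v~v+1 → next≢ v (sym (within-zero v~v+1)))

    territories-apart : ∀ {v w x} → v ≢ w → 0 < f v → 0 < f w → (s : Privacy v) (t : Privacy w) →
                        Between (f v) v (endpoint s) x → Between (f w) w (endpoint t) x → ⊥
    territories-apart v≢w fv>0 fw>0 (boundary bv) (boundary bw) Bv Bw =
      crossing-boundaries {l₁ = left Bv} {right Bv} {left Bw} {right Bw} (left+right≤k Bv) (left+right≤k Bw)
        (privacy-gap (isPrivate bv) (v≢w ∘ sym) fw>0 (to-right Bv) (to-left Bw))
        (privacy-gap (isPrivate bw) v≢w fv>0 (to-right Bw) (to-left Bv))
    territories-apart v≢w fv>0 fw>0 (self fv≡1 priv) (boundary bw) Bv Bw =
      crossing-self-boundary {l₁ = left Bv} {left Bw} {right Bw}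
        (≤-trans (m≤m+n _ _) (subst (_ ≤_) fv≡1 (left+right≤k Bv))) (left+right≤k Bw)
        (privacy-gap priv (v≢w ∘ sym) fw>0 (to-left Bv) (to-left Bw))
        (subst (_< _) fv≡1 (privacy-gap (isPrivate bw) v≢w fv>0 (to-right Bw) (to-left Bv)))
    territories-apart v≢w fv>0 fw>0 s@(boundary _) t@(self _ _) Bv Bw =
      territories-apart (v≢w ∘ sym) fw>0 fv>0 t s Bw Bv
    territories-apart {v} {w} {x} v≢w fv>0 fw>0 (self fv≡1 priv) (self fw≡1 _) Bv Bw =
      v≢w (next-injective next≡)
      where
      ends : right Bv ≡ 0 × right Bw ≡ 0
      ends = crossing-selves {left Bv} {right Bv} {left Bw} {right Bw}
               (subst (_ ≤_) fv≡1 (left+right≤k Bv)) (subst (_ ≤_) fw≡1 (left+right≤k Bw))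
               (subst (_< _) fw≡1 (privacy-gap priv (v≢w ∘ sym) fw>0 (to-left Bv) (to-left Bw)))
      at-end : ∀ {k u e} (B : Between k u e x) → right B ≡ 0 → x ≡ e
      at-end B r≡0 = within-zero (subst (λ r → Within (C n) r x _) r≡0 (to-right B))
      next≡ : next v ≡ next w
      next≡ = subst₂ (λ a b → shift a v ≡ shift b w) fv≡1 fw≡1
                (trans (sym (at-end Bv (proj₁ ends))) (at-end Bw (proj₂ ends)))

    block : ∀ v → Dec (0 < f v) → List (Fin n)
    block v (yes fv>0) = territory (privacy v fv>0)
    block v (no  _)    = []

    length-block : ∀ v d → length (block v d) ≡ f v + positive (f v)
    length-block v (yes fv>0) = trans (length-arc (reach (privacy v fv>0))) (suc≡+positive fv>0)
      where
      suc≡+positive : ∀ {m} → 0 < m → suc m ≡ m + positive m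
      suc≡+positive {suc m} _ = +-comm 1 (suc m)
    length-block v (no  fv≯0) = subst (λ m → 0 ≡ m + positive m) (sym (n≤0⇒n≡0 (≮⇒≥ fv≯0))) refl

    block-unique : ∀ v d → Unique (block v d)
    block-unique v (yes fv>0) = territory-unique fv>0 (privacy v fv>0)
    block-unique v (no  _)    = []

    block-disjoint : ∀ {v w} → v ≢ w → ∀ d e → Disjoint (block v d) (block w e)
    block-disjoint {v} {w} v≢w (yes fv>0) (yes fw>0) (x∈s , x∈t) =
      territories-apart v≢w fv>0 fw>0 s t (∈arc⇒between (reach s) x∈s) (∈arc⇒between (reach t) x∈t)
      where
      s = privacy v fv>0
      t = privacy w fw>0
    block-disjoint v≢w (yes _) (no  _) (_ , ())
    block-disjoint v≢w (no  _) _       (() , _)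

    blocks : Fin n → List (Fin n)
    blocks v = block v (0 <? f v)

    blocks-unique : Unique (concat (map blocks (allFin n)))
    blocks-unique =
      concat⁺ (All.map⁺ (All.universal (λ v → block-unique v (0 <? f v)) (allFin n)))
              (AllPairs.map⁺ (AllPairs.map (λ {v} {w} v≢w {x} → block-disjoint v≢w (0 <? f v) (0 <? f w) {x})
                                           (allFin⁺ n)))

    cost+broadcasters≤n : cost f + broadcasters f ≤ n
    cost+broadcasters≤n = begin
      cost f + broadcasters f                           ≡⟨ sum-map-+ f (positive ∘ f) (allFin n) ⟨
      sum (map (λ v → f v + positive (f v)) (allFin n)) ≡⟨ sum-map-cong (λ v → length-block v (0 <? f v)) (allFin n) ⟨
      sum (map (length ∘ blocks) (allFin n))            ≡⟨ length-concat-map blocks (allFin n) ⟨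
      length (concat (map blocks (allFin n)))           ≤⟨ Unique⇒length≤ blocks-unique ⟩
      n                                                 ∎
      where open ≤-Reasoning

  dominant⇒cost≡⌊n/2⌋ : ∀ {f v} → IsMinimalDominatingBroadcast (C n) f →
                        0 < n / 2 → n / 2 ≤ f v → cost f ≡ n / 2
  dominant⇒cost≡⌊n/2⌋ {f} {v} minimal h>0 h≤fv = begin
    cost f                  ≡⟨ sum-map-cong (λ w → sym (g≡f w)) (allFin n) ⟩
    cost (single v (n / 2)) ≡⟨ cost-single v (n / 2) ⟩
    n / 2                   ∎
    where
    open ≡-Reasoning
    g : Fin n → ℕ
    g = single v (n / 2)
    g≤f : ∀ w → g w ≤ f w
    g≤f w with w ≟ᶠ v
    ... | yes refl = subst (_≤ f v) (sym (single-self v)) h≤fv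
    ... | no  w≢v  = subst (_≤ f w) (sym (single-other w≢v)) z≤n
    g-dominating : IsDominating (C n) g
    g-dominating u = v , hears g (single-self v) h>0 (within-half u v)
    g≡f : ∀ w → g w ≡ f w
    g≡f = proj₂ minimal g (IsBroadcast-mono g≤f (proj₁ (proj₁ minimal)) , g-dominating) g≤f

  upper-bound : ∀ {m f} → 0 < m → n / 2 ≡ suc m → IsMinimalDominatingBroadcast (C n) f → cost f ≤ 2 * m
  upper-bound {m} {f} m>0 half≡ minimal with any? (λ v → n / 2 ≤? f v)
  ... | yes (v , h≤fv) = begin
    cost f ≡⟨ dominant⇒cost≡⌊n/2⌋ minimal (subst (0 <_) (sym half≡) z<s) h≤fv ⟩
    n / 2  ≡⟨ half≡ ⟩
    suc m  ≤⟨ suc≤2* m>0 ⟩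
    2 * m  ∎
    where open ≤-Reasoning
  ... | no  none = cost≤2m (sum≤max*count f below (allFin n)) (begin
    cost f + broadcasters f ≤⟨ cost+broadcasters≤n ⟩
    n                       ≤⟨ n≤1+2⌊n/2⌋ n ⟩
    suc (n / 2 + n / 2)     ≡⟨ cong (λ h → suc (h + h)) half≡ ⟩
    suc (suc m + suc m)     ∎)
    where
    open ≤-Reasoning
    open MinimalBroadcast minimal
    below : ∀ v → f v ≤ m
    below v = s≤s⁻¹ (subst (f v <_) half≡ (≰⇒> λ h≤fv → none (v , h≤fv)))

  -- The lower bound

  module TwoBroadcasters (m a : ℕ) (m>0 : 0 < m) (a>0 : 0 < a) (a≤1+m : a ≤ suc m) (n≡ : n ≡ suc (m + a + m))
    where

    vertex : ∀ i → i ≤ m + a + m → Fin n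
    vertex i i≤ = fromℕ< (subst (i <_) (sym n≡) (s≤s i≤))

    toℕ-vertex : ∀ {i} i≤ → toℕ (vertex i i≤) ≡ i
    toℕ-vertex _ = toℕ-fromℕ< _

    first p q last : Fin n
    first = vertex 0 z≤n
    p     = vertex m (≤-trans (m≤m+n m a) (m≤m+n (m + a) m))
    q     = vertex (m + a) (m≤m+n (m + a) m)
    last  = vertex (m + a + m) ≤-refl

    toℕ-first : toℕ first ≡ 0
    toℕ-first = toℕ-vertex z≤n

    toℕ-p : toℕ p ≡ m
    toℕ-p = toℕ-vertex (≤-trans (m≤m+n m a) (m≤m+n (m + a) m))

    toℕ-q : toℕ q ≡ m + a
    toℕ-q = toℕ-vertex (m≤m+n (m + a) m)

    toℕ-last : toℕ last ≡ m + a + m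
    toℕ-last = toℕ-vertex ≤-refl

    q≢p : q ≢ p
    q≢p q≡p = <-irrefl (trans (sym toℕ-p) (trans (cong toℕ (sym q≡p)) toℕ-q)) (m<m+n m a>0)

    f : Fin n → ℕ
    f w = single p m w + single q m w

    f-p : f p ≡ m
    f-p = trans (cong₂ _+_ (single-self p) (single-other (q≢p ∘ sym))) (+-identityʳ m)

    f-q : f q ≡ m
    f-q = cong₂ _+_ (single-other q≢p) (single-self q)

    f-cases : ∀ w → w ≡ p ⊎ w ≡ q ⊎ f w ≡ 0
    f-cases w with w ≟ᶠ p | w ≟ᶠ q
    ... | yes w≡p | _       = inj₁ w≡p
    ... | no  _   | yes w≡q = inj₂ (inj₁ w≡q)
    ... | no  w≢p | no  w≢q = inj₂ (inj₂ (cong₂ _+_ (single-other w≢p) (single-other w≢q)))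

    cost-f : cost f ≡ 2 * m
    cost-f = begin
      cost f                                ≡⟨ sum-map-+ (single p m) (single q m) (allFin n) ⟩
      cost (single p m) + cost (single q m) ≡⟨ cong₂ _+_ (cost-single p m) (cost-single q m) ⟩
      m + m                                 ≡⟨ cong (m +_) (+-identityʳ m) ⟨
      2 * m                                 ∎
      where open ≡-Reasoning

    apart : ∀ {k x y i j} → toℕ x ≡ i → toℕ y ≡ j → i + k < j → j + k < n + i → ¬ Within (C n) k x y
    apart refl refl = ¬within-arc

    forward : ∀ {k x y i j} → toℕ x ≡ i → toℕ y ≡ j → i ≤ j → j ∸ i ≤ k → Within (C n) k x y
    forward refl refl i≤j j∸i≤k = within-mono j∸i≤k (within-forward i≤j)

    <n+ : ∀ {t} i → t ≤ m + a + m + i → t < n + i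
    <n+ i t≤ = subst (λ z → _ < z + i) (sym n≡) (s≤s t≤)

    first≁q : ¬ Within (C n) m first q
    first≁q = apart toℕ-first toℕ-q (m<m+n m a>0) (<n+ 0 (≤-reflexive (sym (+-identityʳ _))))

    first≁p : ∀ {k} → k < m → ¬ Within (C n) k first p
    first≁p {k} k<m = apart toℕ-first toℕ-p k<m (<n+ 0 (begin
      m + k         ≤⟨ +-monoʳ-≤ m (<⇒≤ k<m) ⟩
      m + m         ≤⟨ +-monoˡ-≤ m (m≤m+n m a) ⟩
      m + a + m     ≡⟨ +-identityʳ _ ⟨
      m + a + m + 0 ∎))
      where open ≤-Reasoning

    p≁last : ¬ Within (C n) m p last
    p≁last = apart toℕ-p toℕ-last (+-monoˡ-< m (m<m+n m a>0)) (<n+ m ≤-refl)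

    q≁last : ∀ {k} → k < m → ¬ Within (C n) k q last
    q≁last {k} k<m = apart toℕ-q toℕ-last (+-monoʳ-< (m + a) k<m)
                       (<n+ (m + a) (+-monoʳ-≤ (m + a + m) (≤-trans (<⇒≤ k<m) (m≤m+n m a))))

    hears-only : ∀ {u w} → Hears f u w → (w ≡ p × Within (C n) m u p) ⊎ (w ≡ q × Within (C n) m u q)
    hears-only {u} {w} (fw>0 , u~w) with f-cases w
    ... | inj₁ refl        = inj₁ (refl , subst (λ k → Within (C n) k u p) f-p u~w)
    ... | inj₂ (inj₁ refl) = inj₂ (refl , subst (λ k → Within (C n) k u q) f-q u~w)
    ... | inj₂ (inj₂ fw≡0) = ⊥-elim (<-irrefl (sym fw≡0) fw>0)

    first-private : PrivateTo f p first
    first-private w w≢p h with hears-only h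
    ... | inj₁ (w≡p , _)      = w≢p w≡p
    ... | inj₂ (_ , first~q) = first≁q first~q

    last-private : PrivateTo f q last
    last-private w w≢q h with hears-only h
    ... | inj₁ (_ , last~p) = p≁last (within-sym last~p)
    ... | inj₂ (w≡q , _)    = w≢q w≡q

    first-boundary : PrivateBoundary f p first
    first-boundary = record
      { isPrivate = first-private
      ; reaches   = subst (λ k → Within (C n) k first p) (sym f-p) (forward toℕ-first toℕ-p z≤n ≤-refl)
      ; exact     = λ k<f → first≁p (subst (_ <_) f-p k<f) }

    last-boundary : PrivateBoundary f q last
    last-boundary = record
      { isPrivate = last-private
      ; reaches   = subst (λ k → Within (C n) k last q) (sym f-q)
                      (within-sym (forward toℕ-q toℕ-last (m≤m+n (m + a) m) (≤-reflexive (m+n∸m≡n (m + a) m))))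
      ; exact     = λ k<f last~q → q≁last (subst (_ <_) f-q k<f) (within-sym last~q) }

    f-broadcast : IsBroadcast (C n) f
    f-broadcast w with f-cases w
    ... | inj₁ refl        = boundary⇒≤Ecc first-boundary
    ... | inj₂ (inj₁ refl) = boundary⇒≤Ecc last-boundary
    ... | inj₂ (inj₂ fw≡0) = subst (≤Ecc (C n) w) (sym fw≡0) (w , λ _ ())

    f-dominating : IsDominating (C n) f
    f-dominating u with toℕ u <? m + a | toℕ u ≤? m
    ... | yes _   | yes u≤m = p , hears f f-p m>0 (forward refl toℕ-p u≤m (m∸n≤m m (toℕ u)))
    ... | yes u<q | no  u≰m = p , hears f f-p m>0 (within-sym (forward toℕ-p refl (≰⇒≥ u≰m) (begin
      toℕ u ∸ m ≤⟨ ∸-monoˡ-≤ m (s≤s⁻¹ (≤-trans u<q q≤1+2m)) ⟩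
      m + m ∸ m ≡⟨ m+n∸m≡n m m ⟩
      m         ∎)))
      where
      open ≤-Reasoning
      q≤1+2m : m + a ≤ suc (m + m)
      q≤1+2m = subst (m + a ≤_) (+-suc m m) (+-monoʳ-≤ m a≤1+m)
    ... | no  u≮q | _       = q , hears f f-q m>0 (within-sym (forward toℕ-q refl (≮⇒≥ u≮q) (begin
      toℕ u ∸ (m + a)     ≤⟨ ∸-monoˡ-≤ (m + a) (s≤s⁻¹ (subst (toℕ u <_) n≡ (toℕ<n u))) ⟩
      m + a + m ∸ (m + a) ≡⟨ m+n∸m≡n (m + a) m ⟩
      m                   ∎)))
      where open ≤-Reasoning

    f-minimal : IsMinimalDominatingBroadcast (C n) f
    f-minimal = (f-broadcast , f-dominating) , λ g (_ , gD) g≤f → boundaries⇒minimal boundary gD g≤f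
      where
      boundary : ∀ v → 0 < f v → ∃ (PrivateBoundary f v)
      boundary v fv>0 with f-cases v
      ... | inj₁ refl        = first , first-boundary
      ... | inj₂ (inj₁ refl) = last , last-boundary
      ... | inj₂ (inj₂ fv≡0) = ⊥-elim (<-irrefl (sym fv≡0) fv>0)

  lower-bound : ∀ {m} → 0 < m → n / 2 ≡ suc m →
                ∃ λ f → IsMinimalDominatingBroadcast (C n) f × cost f ≡ 2 * m
  lower-bound {m} m>0 half≡ with split-cycle half≡
  ... | a , a>0 , a≤2 , n≡ = f , f-minimal , cost-f
    where open TwoBroadcasters m a m>0 a>0 (≤-trans a≤2 (s≤s m>0)) n≡

theorem3p4 : ∀ (n : ℕ) → 4 ≤ n → UpperBroadcastNumber (C n) (2 * ((n / 2) ∸ 1))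
theorem3p4 n 4≤n = lower-bound m>0 half≡ , λ _ → upper-bound m>0 half≡
  where
  open Cycle n (≤-trans (s≤s (s≤s z≤n)) 4≤n)
  2≤half : 2 ≤ n / 2
  2≤half = /-monoˡ-≤ 2 4≤n
  half≡ : n / 2 ≡ suc (n / 2 ∸ 1)
  half≡ = sym (m+[n∸m]≡n (≤-trans (s≤s z≤n) 2≤half))
  m>0 : 0 < n / 2 ∸ 1
  m>0 = s≤s⁻¹ (subst (2 ≤_) half≡ 2≤half)
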